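{- Let $G$ be a graph with $n$ vertices and $m$ edges, and suppose $G_1$, $G_2$ are induced subgraphs of $G$ with $G=G_1\cup G_2$ and such that $G_1\cap G_2$ is a complete graph on $k$ vertices. Suppose $G_i$ has $n_i$ vertices and $m_i$ edges ($i=1,2$). Let $x,y,z$ be real numbers such that $c(G_i)\leq xn_i+ym_i+z$ for $i=1,2$ and $xk+y\binom{k}{2}+z\leq 2^k$. Then $c(G)\leq xn+ym+z$.
   Context: All graphs are finite, simple and undirected. A clique is a (possibly empty) set of pairwise adjacent vertices; $c(H)$ denotes the number of cliques of $H$ (including $\emptyset$ and single vertices).
   Formalization: The numbers x, y, z range over the rationals instead of the reals. -}

module Defs where

open import Data.Nat using (ℕ; zero; suc; _<ᵇ_; _+_)
open import Data.Bool using (Bool; true; false; _∧_; _∨_; not; T)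
open import Data.Fin using (Fin; toℕ; _≟_)
open import Data.List using (List; []; _∷_; map; filter; length; allFin; _++_)
open import Data.Vec using (Vec; []; _∷_; lookup)
open import Data.Fin.Subset using (Subset; inside; outside)
open import Relation.Binary.PropositionalEquality using (_≡_)
open import Relation.Nullary using (does)
open import Data.Integer using (+_)
open import Data.Rational using (ℚ; _/_)

record Graph (n : ℕ) : Set where
  field
    adj    : Fin n → Fin n → Bool
    sym    : ∀ i j → adj i j ≡ adj j i
    irrefl : ∀ i → adj i i ≡ false
open Graph public

allSubsets : (n : ℕ) → List (Subset n)
allSubsets zero    = [] ∷ []
allSubsets (suc n) = map (outside ∷_) (allSubsets n) ++ map (inside ∷_) (allSubsets n)

memb : ∀ {n} → Fin n → Subset n → Bool
memb i S = lookup S i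

allV : ∀ {n} → (Fin n → Bool) → Bool
allV {n} f = go (allFin n)
  where
  go : List (Fin n) → Bool
  go []       = true
  go (i ∷ is) = f i ∧ go is

countB : ∀ {A : Set} → (A → Bool) → List A → ℕ
countB p []       = 0
countB p (a ∷ as) with p a
... | true  = suc (countB p as)
... | false = countB p as

subsetB : ∀ {n} → Subset n → Subset n → Bool
subsetB T S = allV (λ i → not (memb i T) ∨ memb i S)

isCliqueB : ∀ {n} → Graph n → Subset n → Bool
isCliqueB G T =
  allV (λ i → allV (λ j →
    not (memb i T ∧ memb j T) ∨ does (i ≟ j) ∨ adj G i j))

-- c(G[S]) : number of cliques (including ∅ and singletons) of the
-- subgraph of G induced on the vertex set S.
cliquesIn : ∀ {n} → Graph n → Subset n → ℕ
cliquesIn {n} G S = countB (λ T → subsetB T S ∧ isCliqueB G T) (allSubsets n)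

edgesIn : ∀ {n} → Graph n → Subset n → ℕ
edgesIn {n} G S = sumL (map (λ i → countB (λ j →
    (toℕ i <ᵇ toℕ j) ∧ memb i S ∧ memb j S ∧ adj G i j) (allFin n)) (allFin n))
  where
  sumL : List ℕ → ℕ
  sumL []       = 0
  sumL (a ∷ as) = a + sumL as

ℕtoℚ : ℕ → ℚ
ℕtoℚ m = (+ m) / 1

{-# OPTIONS --safe #-}
-- Every clique of G lies inside G₁ or inside G₂: two of its vertices on
-- different sides would be an edge between G₁ − G₂ and G₂ − G₁.  The cliques
-- lying in both are the subsets of the complete graph G₁ ∩ G₂.  By
-- inclusion–exclusion, vertices, edges and cliques are therefore all
-- additive over the decomposition up to the contribution of K_k:
--   n + k = n₁ + n₂,   m + C(k,2) = m₁ + m₂,   c(G) + 2^k = c(G₁) + c(G₂).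
-- The bound xn + ym + z is affine, so adding the bounds for G₁ and G₂ and
-- using the one for K_k gives c(G) + 2^k ≤ xn + ym + z + 2^k.
module Submission where

module Booleans where
  open import Data.Bool using (true; false; T; not; _∧_; _∨_)
  open import Data.Empty using (⊥-elim)
  open import Function using (_⇔_; mk⇔)
  open import Relation.Binary.PropositionalEquality using (_≡_; refl)
  open import Relation.Nullary using (Dec; yes; no; does; ¬_)

  T-injective : ∀ {a b} → (T a → T b) → (T b → T a) → a ≡ b
  T-injective {true}  {true}  _   _   = refl
  T-injective {true}  {false} a⇒b _   = ⊥-elim (a⇒b _)
  T-injective {false} {true}  _   b⇒a = ⊥-elim (b⇒a _)
  T-injective {false} {false} _   _   = refl

  T-not-∨ : ∀ {a b} → T (not a ∨ b) ⇔ (T a → T b)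
  T-not-∨ {true}  = mk⇔ (λ b _ → b) (λ a⇒b → a⇒b _)
  T-not-∨ {false} = mk⇔ (λ _ ()) (λ _ → _)

  T-does-∨ : ∀ {P : Set} (P? : Dec P) {b} → T (does P? ∨ b) ⇔ (¬ P → T b)
  T-does-∨ (yes p) = mk⇔ (λ _ ¬p → ⊥-elim (¬p p)) (λ _ → _)
  T-does-∨ (no ¬p) = mk⇔ (λ b _ → b) (λ ¬p⇒b → ¬p⇒b ¬p)

  ∧-redundantʳ : ∀ {a b} → (T a → T b) → a ∧ b ≡ a
  ∧-redundantʳ {true}  {true}  _   = refl
  ∧-redundantʳ {true}  {false} a⇒b = ⊥-elim (a⇒b _)
  ∧-redundantʳ {false}         _   = refl

module Counting where
  open import Data.Bool using (Bool; true; false; T; _∧_; _∨_; if_then_else_)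
  open import Data.Empty using (⊥-elim)
  open import Data.Fin using (Fin; zero; suc)
  open import Data.List using (List; []; _∷_; _++_; map; allFin)
  open import Data.List.Properties using (map-cong; map-tabulate)
  open import Data.Nat using (ℕ; suc; _+_)
  open import Data.Nat.ListAction using (sum)
  open import Data.Nat.Properties using (+-identityʳ; +-commutativeSemigroup)
  open import Algebra.Properties.CommutativeSemigroup +-commutativeSemigroup using (interchange)
  open import Function using (_∘_)
  open import Relation.Binary.PropositionalEquality
  open import Defs using (countB)

  private variable
    A B : Set
    n : ℕ

  indicator : Bool → ℕ
  indicator b = if b then 1 else 0

  indicator-inclusion-exclusion : ∀ u v c → (T c → T (u ∨ v)) →
    indicator (u ∧ c) + indicator (v ∧ c) ≡ indicator c + indicator ((u ∧ v) ∧ c)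
  indicator-inclusion-exclusion true  true  c     _     = refl
  indicator-inclusion-exclusion true  false c     _     = refl
  indicator-inclusion-exclusion false true  c     _     = sym (+-identityʳ (indicator c))
  indicator-inclusion-exclusion false false true  c⇒u∨v = ⊥-elim (c⇒u∨v _)
  indicator-inclusion-exclusion false false false _     = refl

  sum-map-+ : (f g : A → ℕ) (xs : List A) →
    sum (map (λ a → f a + g a) xs) ≡ sum (map f xs) + sum (map g xs)
  sum-map-+ f g []       = refl
  sum-map-+ f g (a ∷ as) =
    trans (cong (f a + g a +_) (sum-map-+ f g as)) (interchange (f a) (g a) _ _)

  sum-map-+-cong : {f g h k : A → ℕ} → (∀ a → f a + g a ≡ h a + k a) → (xs : List A) →
    sum (map f xs) + sum (map g xs) ≡ sum (map h xs) + sum (map k xs)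
  sum-map-+-cong {f = f} {g} {h} {k} eq xs = begin
    sum (map f xs) + sum (map g xs)  ≡⟨ sum-map-+ f g xs ⟨
    sum (map (λ a → f a + g a) xs)   ≡⟨ cong sum (map-cong eq xs) ⟩
    sum (map (λ a → h a + k a) xs)   ≡⟨ sum-map-+ h k xs ⟩
    sum (map h xs) + sum (map k xs)  ∎
    where open ≡-Reasoning

  countB≡sum : (p : A → Bool) (xs : List A) → countB p xs ≡ sum (map (indicator ∘ p) xs)
  countB≡sum p []       = refl
  countB≡sum p (a ∷ as) with p a
  ... | true  = cong suc (countB≡sum p as)
  ... | false = countB≡sum p as

  countB-cong : {p q : A → Bool} → (∀ a → p a ≡ q a) → (xs : List A) → countB p xs ≡ countB q xs
  countB-cong {p = p} {q} eq xs = begin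
    countB p xs                   ≡⟨ countB≡sum p xs ⟩
    sum (map (indicator ∘ p) xs)  ≡⟨ cong sum (map-cong (cong indicator ∘ eq) xs) ⟩
    sum (map (indicator ∘ q) xs)  ≡⟨ countB≡sum q xs ⟨
    countB q xs                   ∎
    where open ≡-Reasoning

  countB-+-cong : {p q r s : A → Bool} →
    (∀ a → indicator (p a) + indicator (q a) ≡ indicator (r a) + indicator (s a)) → (xs : List A) →
    countB p xs + countB q xs ≡ countB r xs + countB s xs
  countB-+-cong {p = p} {q} {r} {s} eq xs = begin
    countB p xs + countB q xs
      ≡⟨ cong₂ _+_ (countB≡sum p xs) (countB≡sum q xs) ⟩
    sum (map (indicator ∘ p) xs) + sum (map (indicator ∘ q) xs)
      ≡⟨ sum-map-+-cong eq xs ⟩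
    sum (map (indicator ∘ r) xs) + sum (map (indicator ∘ s) xs)
      ≡⟨ cong₂ _+_ (countB≡sum r xs) (countB≡sum s xs) ⟨
    countB r xs + countB s xs
      ∎
    where open ≡-Reasoning

  countB-inclusion-exclusion : (p q r : A → Bool) → (∀ a → T (r a) → T (p a ∨ q a)) → (xs : List A) →
    countB (λ a → p a ∧ r a) xs + countB (λ a → q a ∧ r a) xs
      ≡ countB r xs + countB (λ a → (p a ∧ q a) ∧ r a) xs
  countB-inclusion-exclusion p q r r⊆p∪q =
    countB-+-cong (λ a → indicator-inclusion-exclusion (p a) (q a) (r a) (r⊆p∪q a))

  countB-false : (xs : List A) → countB (λ _ → false) xs ≡ 0
  countB-false []       = refl
  countB-false (_ ∷ xs) = countB-false xs

  countB-++ : (p : A → Bool) (xs ys : List A) → countB p (xs ++ ys) ≡ countB p xs + countB p ys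
  countB-++ p []       ys = refl
  countB-++ p (x ∷ xs) ys with p x
  ... | true  = cong suc (countB-++ p xs ys)
  ... | false = countB-++ p xs ys

  countB-map : (p : B → Bool) (f : A → B) (xs : List A) → countB p (map f xs) ≡ countB (p ∘ f) xs
  countB-map p f []       = refl
  countB-map p f (x ∷ xs) with p (f x)
  ... | true  = cong suc (countB-map p f xs)
  ... | false = countB-map p f xs

  map-allFin-suc : (f : Fin (suc n) → A) → map f (allFin (suc n)) ≡ f zero ∷ map (f ∘ suc) (allFin n)
  map-allFin-suc f = cong (f zero ∷_) (trans (map-tabulate suc f) (sym (map-tabulate (λ i → i) (f ∘ suc))))

  countB-allFin-suc : (p : Fin (suc n) → Bool) →
    countB p (allFin (suc n)) ≡ indicator (p zero) + countB (p ∘ suc) (allFin n)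
  countB-allFin-suc {n} p = begin
    countB p (allFin (suc n))
      ≡⟨ countB≡sum p (allFin (suc n)) ⟩
    sum (map (indicator ∘ p) (allFin (suc n)))
      ≡⟨ cong sum (map-allFin-suc (indicator ∘ p)) ⟩
    indicator (p zero) + sum (map (indicator ∘ p ∘ suc) (allFin n))
      ≡⟨ cong (indicator (p zero) +_) (countB≡sum (p ∘ suc) (allFin n)) ⟨
    indicator (p zero) + countB (p ∘ suc) (allFin n)
      ∎
    where open ≡-Reasoning

  countPairs : (Fin n → Fin n → Bool) → ℕ
  countPairs {n} P = sum (map (λ i → countB (P i) (allFin n)) (allFin n))

  countPairs-cong : {P Q : Fin n → Fin n → Bool} → (∀ i j → P i j ≡ Q i j) → countPairs P ≡ countPairs Q
  countPairs-cong {n} eq = cong sum (map-cong (λ i → countB-cong (eq i) (allFin n)) (allFin n))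

  countPairs-inclusion-exclusion : (P Q R : Fin n → Fin n → Bool) → (∀ i j → T (R i j) → T (P i j ∨ Q i j)) →
    countPairs (λ i j → P i j ∧ R i j) + countPairs (λ i j → Q i j ∧ R i j)
      ≡ countPairs R + countPairs (λ i j → (P i j ∧ Q i j) ∧ R i j)
  countPairs-inclusion-exclusion {n} P Q R R⊆P∪Q =
    sum-map-+-cong (λ i → countB-inclusion-exclusion (P i) (Q i) (R i) (R⊆P∪Q i) (allFin n)) (allFin n)

module Subsets where
  open import Data.Bool using (Bool; true; false; T; not; _∧_; _∨_)
  open import Data.Bool.ListAction using (and; all)
  open import Data.Product using (_×_; _,_)
  open import Data.Bool.Properties using (T-≡; T-∧; ∧-commutativeMonoid)
  open import Algebra.Bundles using (CommutativeMonoid)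
  open import Algebra.Properties.CommutativeSemigroup (CommutativeMonoid.commutativeSemigroup ∧-commutativeMonoid)
    using () renaming (interchange to ∧-interchange)
  open import Data.Fin using (Fin; zero; suc; toℕ)
  open import Data.Fin.Subset using (Subset; _∈_; _⊆_; _∩_; _∪_; ⊤; ∣_∣)
  open import Data.Fin.Subset.Properties using (⊆⊤; p∩q⊆p; p∩q⊆q; x∈p∩q⁺)
  open import Data.List using (List; _++_; map; allFin)
  open import Data.List.Properties using (foldr-universal; map-cong)
  open import Data.List.Relation.Unary.All.Properties using (all⁺; all⁻; tabulate⁺; tabulate⁻)
  open import Data.Nat using (ℕ; suc; _+_; _^_; _<ᵇ_)
  open import Data.Nat.Combinatorics using (_C_; nC1≡n; nCk+nC[k+1]≡[n+1]C[k+1])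
  open import Data.Nat.ListAction using (sum)
  open import Data.Nat.Properties using (+-identityʳ; +-suc)
  open import Data.Vec using ([]; _∷_)
  open import Data.Vec.Properties using (lookup⇒[]=; []=⇒lookup; lookup-replicate; lookup-zipWith)
  open import Function using (_∘_; _⇔_; mk⇔; Equivalence)
  open Equivalence using (to; from)
  open import Relation.Binary.PropositionalEquality
  open import Defs using (allV; memb; subsetB; allSubsets; countB)
  open Booleans
  open Counting

  private variable
    n : ℕ

  -- `_` is unified with the helper go local to allV, which cannot be named; it is
  -- created outside the with-abstraction so that `_ is = go is` is a pattern.
  allV≡all : (f : Fin n → Bool) → allV f ≡ all f (allFin n)
  allV≡all {n} f with allFin n | foldr-universal _ (λ i b → f i ∧ b) true refl (λ _ _ → refl)
  ... | is | go≗foldr =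
    trans (go≗foldr is) (sym (foldr-universal (all f) (λ i b → f i ∧ b) true refl (λ _ _ → refl) is))

  T-allV : {f : Fin n → Bool} → T (allV f) ⇔ (∀ i → T (f i))
  T-allV {n} {f} = mk⇔
    (λ t → tabulate⁻ (all⁺ f (allFin n) (subst T (allV≡all f) t)))
    (λ h → subst T (sym (allV≡all f)) (all⁻ f (tabulate⁺ h)))

  allV-suc : (f : Fin (suc n) → Bool) → allV f ≡ f zero ∧ allV (f ∘ suc)
  allV-suc {n} f = begin
    allV f                                ≡⟨ allV≡all f ⟩
    and (map f (allFin (suc n)))          ≡⟨ cong and (map-allFin-suc f) ⟩
    f zero ∧ all (f ∘ suc) (allFin n)     ≡⟨ cong (f zero ∧_) (allV≡all (f ∘ suc)) ⟨
    f zero ∧ allV (f ∘ suc)               ∎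
    where open ≡-Reasoning

  T-memb : ∀ i (p : Subset n) → T (memb i p) ⇔ i ∈ p
  T-memb i p = mk⇔ (lookup⇒[]= i p ∘ to T-≡) (from T-≡ ∘ []=⇒lookup)

  T-subsetB : (p q : Subset n) → T (subsetB p q) ⇔ p ⊆ q
  T-subsetB p q = mk⇔
    (λ t {i} i∈p → to (T-memb i q) (to T-not-∨ (to T-allV t i) (from (T-memb i p) i∈p)))
    (λ p⊆q → from T-allV (λ i → from T-not-∨ (from (T-memb i q) ∘ p⊆q ∘ to (T-memb i p))))

  subsetB-⊤ : (p : Subset n) → subsetB p ⊤ ≡ true
  subsetB-⊤ p = to T-≡ (from (T-subsetB p ⊤) ⊆⊤)

  subsetB-∩ : (p q r : Subset n) → subsetB p (q ∩ r) ≡ subsetB p q ∧ subsetB p r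
  subsetB-∩ p q r = T-injective
    (λ t → let p⊆q∩r = to (T-subsetB p (q ∩ r)) t in
      from T-∧ (from (T-subsetB p q) (p∩q⊆p q r ∘ p⊆q∩r) , from (T-subsetB p r) (p∩q⊆q q r ∘ p⊆q∩r)))
    (λ t → let (p⊆q , p⊆r) = to (T-∧ {subsetB p q}) t in
      from (T-subsetB p (q ∩ r))
        (λ i∈p → x∈p∩q⁺ (to (T-subsetB p q) p⊆q i∈p , to (T-subsetB p r) p⊆r i∈p)))

  subsetB-∷ : ∀ a b (p q : Subset n) → subsetB (a ∷ p) (b ∷ q) ≡ (not a ∨ b) ∧ subsetB p q
  subsetB-∷ a b p q = allV-suc (λ i → not (memb i (a ∷ p)) ∨ memb i (b ∷ q))

  countB-subsetB-∷ : ∀ b (q : Subset n) →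
    countB (λ p → subsetB p (b ∷ q)) (allSubsets (suc n))
      ≡ countB (λ p → subsetB p q) (allSubsets n) + countB (λ p → b ∧ subsetB p q) (allSubsets n)
  countB-subsetB-∷ {n} b q = begin
    countB (λ p → subsetB p (b ∷ q)) (map (false ∷_) ps ++ map (true ∷_) ps)
      ≡⟨ countB-++ _ (map (false ∷_) ps) _ ⟩
    countB (λ p → subsetB p (b ∷ q)) (map (false ∷_) ps)
      + countB (λ p → subsetB p (b ∷ q)) (map (true ∷_) ps)
      ≡⟨ cong₂ _+_ (countB-map _ (false ∷_) ps) (countB-map _ (true ∷_) ps) ⟩
    countB (λ p → subsetB (false ∷ p) (b ∷ q)) ps + countB (λ p → subsetB (true ∷ p) (b ∷ q)) ps
      ≡⟨ cong₂ _+_ (countB-cong (λ p → subsetB-∷ false b p q) ps)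
                   (countB-cong (λ p → subsetB-∷ true b p q) ps) ⟩
    countB (λ p → subsetB p q) ps + countB (λ p → b ∧ subsetB p q) ps
      ∎
    where
    open ≡-Reasoning
    ps : List (Subset n)
    ps = allSubsets n

  countB-subsetB : (q : Subset n) → countB (λ p → subsetB p q) (allSubsets n) ≡ 2 ^ ∣ q ∣
  countB-subsetB []                  = refl
  countB-subsetB (true ∷ q)          = trans (countB-subsetB-∷ true q)
    (cong₂ _+_ (countB-subsetB q) (trans (countB-subsetB q) (sym (+-identityʳ (2 ^ ∣ q ∣)))))
  countB-subsetB {suc n} (false ∷ q) = trans (countB-subsetB-∷ false q)
    (trans (cong₂ _+_ (countB-subsetB q) (countB-false (allSubsets n))) (+-identityʳ (2 ^ ∣ q ∣)))

  countB-memb : (p : Subset n) → countB (λ i → memb i p) (allFin n) ≡ ∣ p ∣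
  countB-memb []          = refl
  countB-memb (true ∷ p)  = trans (countB-allFin-suc (λ i → memb i (true ∷ p))) (cong suc (countB-memb p))
  countB-memb (false ∷ p) = trans (countB-allFin-suc (λ i → memb i (false ∷ p))) (countB-memb p)

  pairIn : Subset n → Fin n → Fin n → Bool
  pairIn p i j = memb i p ∧ memb j p

  T-pairIn : ∀ (p : Subset n) i j → T (pairIn p i j) ⇔ (i ∈ p × j ∈ p)
  T-pairIn p i j = mk⇔
    (λ t → let (ti , tj) = to T-∧ t in to (T-memb i p) ti , to (T-memb j p) tj)
    (λ (i∈p , j∈p) → from T-∧ (from (T-memb i p) i∈p , from (T-memb j p) j∈p))

  pairIn-⊤ : ∀ i j → pairIn (⊤ {n}) i j ≡ true
  pairIn-⊤ i j = cong₂ _∧_ (lookup-replicate i true) (lookup-replicate j true)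

  pairIn-∩ : (p q : Subset n) → ∀ i j → pairIn (p ∩ q) i j ≡ pairIn p i j ∧ pairIn q i j
  pairIn-∩ p q i j = begin
    memb i (p ∩ q) ∧ memb j (p ∩ q)
      ≡⟨ cong₂ _∧_ (lookup-zipWith _∧_ i p q) (lookup-zipWith _∧_ j p q) ⟩
    (memb i p ∧ memb i q) ∧ (memb j p ∧ memb j q)
      ≡⟨ ∧-interchange (memb i p) (memb i q) (memb j p) (memb j q) ⟩
    (memb i p ∧ memb j p) ∧ (memb i q ∧ memb j q)
      ∎
    where open ≡-Reasoning

  pairsIn : Subset n → ℕ
  pairsIn p = countPairs (λ i j → (toℕ i <ᵇ toℕ j) ∧ pairIn p i j)

  pairsIn-∷ : ∀ b (p : Subset n) → pairsIn (b ∷ p) ≡ countB (λ j → b ∧ memb j p) (allFin n) + pairsIn p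
  pairsIn-∷ {n} b p = begin
    sum (map row (allFin (suc n)))
      ≡⟨ cong sum (map-allFin-suc row) ⟩
    row zero + sum (map (row ∘ suc) (allFin n))
      ≡⟨ cong₂ _+_ (countB-allFin-suc (P zero))
                   (cong sum (map-cong (countB-allFin-suc ∘ P ∘ suc) (allFin n))) ⟩
    countB (λ j → b ∧ memb j p) (allFin n) + pairsIn p
      ∎
    where
    open ≡-Reasoning
    P : Fin (suc n) → Fin (suc n) → Bool
    P i j = (toℕ i <ᵇ toℕ j) ∧ pairIn (b ∷ p) i j
    row : Fin (suc n) → ℕ
    row i = countB (P i) (allFin (suc n))

  pairsIn≡∣p∣C2 : (p : Subset n) → pairsIn p ≡ ∣ p ∣ C 2
  pairsIn≡∣p∣C2 []          = refl
  pairsIn≡∣p∣C2 (true ∷ p)  = begin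
    pairsIn (true ∷ p)
      ≡⟨ pairsIn-∷ true p ⟩
    countB (λ j → memb j p) (allFin _) + pairsIn p
      ≡⟨ cong₂ _+_ (trans (countB-memb p) (sym (nC1≡n ∣ p ∣))) (pairsIn≡∣p∣C2 p) ⟩
    ∣ p ∣ C 1 + ∣ p ∣ C 2
      ≡⟨ nCk+nC[k+1]≡[n+1]C[k+1] ∣ p ∣ 1 ⟩
    suc ∣ p ∣ C 2
      ∎
    where open ≡-Reasoning
  pairsIn≡∣p∣C2 {suc n} (false ∷ p) =
    trans (pairsIn-∷ false p) (cong₂ _+_ (countB-false (allFin n)) (pairsIn≡∣p∣C2 p))

  ∣p∣+∣q∣≡∣p∪q∣+∣p∩q∣ : (p q : Subset n) → ∣ p ∣ + ∣ q ∣ ≡ ∣ p ∪ q ∣ + ∣ p ∩ q ∣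
  ∣p∣+∣q∣≡∣p∪q∣+∣p∩q∣ []          []          = refl
  ∣p∣+∣q∣≡∣p∪q∣+∣p∩q∣ (true ∷ p)  (true ∷ q)  =
    cong suc (trans (+-suc ∣ p ∣ ∣ q ∣) (trans (cong suc (∣p∣+∣q∣≡∣p∪q∣+∣p∩q∣ p q)) (sym (+-suc _ _))))
  ∣p∣+∣q∣≡∣p∪q∣+∣p∩q∣ (true ∷ p)  (false ∷ q) = cong suc (∣p∣+∣q∣≡∣p∪q∣+∣p∩q∣ p q)
  ∣p∣+∣q∣≡∣p∪q∣+∣p∩q∣ (false ∷ p) (true ∷ q)  =
    trans (+-suc ∣ p ∣ ∣ q ∣) (cong suc (∣p∣+∣q∣≡∣p∪q∣+∣p∩q∣ p q))
  ∣p∣+∣q∣≡∣p∪q∣+∣p∩q∣ (false ∷ p) (false ∷ q) = ∣p∣+∣q∣≡∣p∪q∣+∣p∩q∣ p q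

module Graphs where
  open import Data.Bool using (Bool; T; _∧_; _∨_)
  open import Data.Bool.Properties using (T-∧; T-∨; ∧-assoc; ∧-commutativeMonoid)
  open import Algebra.Bundles using (CommutativeMonoid)
  open import Algebra.Properties.CommutativeSemigroup (CommutativeMonoid.commutativeSemigroup ∧-commutativeMonoid)
    using (x∙yz≈y∙xz; x∙yz≈yx∙z)
  open import Data.Empty using (⊥-elim)
  open import Data.Fin using (Fin; toℕ; _≟_)
  open import Data.Fin.Properties using (any?)
  open import Data.Fin.Subset using (Subset; _∈_; _∉_; _⊆_; _∩_; _∪_; ⊤; ∣_∣)
  open import Data.Fin.Subset.Properties using (_∈?_; ∈⊤; x∈p∪q⁻; ∣⊤∣≡n)
  open import Data.List using (List; map; allFin)
  open import Data.List.Properties using (foldr-universal)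
  open import Data.Nat using (ℕ; _+_; _^_; _<ᵇ_)
  open import Data.Nat.Combinatorics using (_C_)
  open import Data.Nat.Properties using (<ᵇ⇒<; <-irrefl)
  open import Data.Product using (_×_; _,_; proj₂)
  open import Data.Sum as Sum using (_⊎_; inj₁; inj₂)
  open import Function using (_∘_; _⇔_; mk⇔; Equivalence)
  open Equivalence using (to; from)
  open import Relation.Binary.PropositionalEquality
  open import Relation.Nullary using (yes; no; ¬_; _×-dec_; ¬?)
  open import Relation.Nullary.Decidable using (decidable-stable)
  open import Defs
    using (Graph; adj; memb; subsetB; isCliqueB; allSubsets; countB; cliquesIn; edgesIn)
  open Booleans
  open Counting
  open Subsets

  ascending⇒≢ : ∀ {n} {i j : Fin n} → T (toℕ i <ᵇ toℕ j) → i ≢ j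
  ascending⇒≢ {i = i} i<j refl = <-irrefl refl (<ᵇ⇒< (toℕ i) (toℕ i) i<j)

  module _ {n : ℕ} (G : Graph n) where

    T-isCliqueB : (p : Subset n) →
      T (isCliqueB G p) ⇔ (∀ {i j} → i ∈ p → j ∈ p → i ≢ j → T (adj G i j))
    T-isCliqueB p = mk⇔
      (λ t {i} {j} i∈p j∈p → to (T-does-∨ (i ≟ j))
        (to T-not-∨ (to T-allV (to T-allV t i) j) (from (T-pairIn p i j) (i∈p , j∈p))))
      (λ clique → from T-allV λ i → from T-allV λ j → from T-not-∨ λ t →
        let (i∈p , j∈p) = to (T-pairIn p i j) t in from (T-does-∨ (i ≟ j)) (clique i∈p j∈p))

    isCliqueB-⊆ : ∀ {p q} → p ⊆ q → T (isCliqueB G q) → T (isCliqueB G p)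
    isCliqueB-⊆ {p} {q} p⊆q t =
      from (T-isCliqueB p) (λ i∈p j∈p → to (T-isCliqueB q) t (p⊆q i∈p) (p⊆q j∈p))

    -- `_` is unified with the helper sumL local to edgesIn, which cannot be named;
    -- it is created outside the with-abstraction so that `_ rows = sumL rows` is a pattern.
    edgesIn≡countPairs : (p : Subset n) →
      edgesIn G p ≡ countPairs (λ i j → (toℕ i <ᵇ toℕ j) ∧ memb i p ∧ memb j p ∧ adj G i j)
    edgesIn≡countPairs p with map (λ i → countB (λ j →
        (toℕ i <ᵇ toℕ j) ∧ memb i p ∧ memb j p ∧ adj G i j) (allFin n)) (allFin n)
                            | foldr-universal _ _+_ 0 refl (λ _ _ → refl)
    ... | rows | sumL≗sum = sumL≗sum rows

    edgesIn≡countPairs-pairIn : (p : Subset n) →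
      edgesIn G p ≡ countPairs (λ i j → pairIn p i j ∧ ((toℕ i <ᵇ toℕ j) ∧ adj G i j))
    edgesIn≡countPairs-pairIn p = trans (edgesIn≡countPairs p) (countPairs-cong λ i j →
      trans (cong ((toℕ i <ᵇ toℕ j) ∧_) (sym (∧-assoc (memb i p) (memb j p) (adj G i j))))
            (x∙yz≈y∙xz (toℕ i <ᵇ toℕ j) (pairIn p i j) (adj G i j)))

    cliquesIn-complete : ∀ {p} → T (isCliqueB G p) → cliquesIn G p ≡ 2 ^ ∣ p ∣
    cliquesIn-complete {p} clique = trans
      (countB-cong (λ X → ∧-redundantʳ (λ X⊆p → isCliqueB-⊆ (to (T-subsetB X p) X⊆p) clique)) (allSubsets n))
      (countB-subsetB p)

    edgesIn-complete : ∀ {p} → T (isCliqueB G p) → edgesIn G p ≡ ∣ p ∣ C 2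
    edgesIn-complete {p} clique = begin
      edgesIn G p
        ≡⟨ edgesIn≡countPairs-pairIn p ⟩
      countPairs (λ i j → pairIn p i j ∧ ((toℕ i <ᵇ toℕ j) ∧ adj G i j))
        ≡⟨ countPairs-cong pair-is-edge ⟩
      pairsIn p
        ≡⟨ pairsIn≡∣p∣C2 p ⟩
      ∣ p ∣ C 2
        ∎
      where
      open ≡-Reasoning
      pair-is-edge : ∀ i j →
        pairIn p i j ∧ ((toℕ i <ᵇ toℕ j) ∧ adj G i j) ≡ (toℕ i <ᵇ toℕ j) ∧ pairIn p i j
      pair-is-edge i j = trans (x∙yz≈yx∙z (pairIn p i j) (toℕ i <ᵇ toℕ j) (adj G i j)) (∧-redundantʳ λ t →
        let (i<j , ij∈p) = to (T-∧ {toℕ i <ᵇ toℕ j}) t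
            (i∈p , j∈p)  = to (T-pairIn p i j) ij∈p
        in  to (T-isCliqueB p) clique i∈p j∈p (ascending⇒≢ i<j))

    cliquesIn-inclusion-exclusion : ∀ {p q} → (∀ X → T (isCliqueB G X) → T (subsetB X p ∨ subsetB X q)) →
      cliquesIn G p + cliquesIn G q ≡ cliquesIn G ⊤ + cliquesIn G (p ∩ q)
    cliquesIn-inclusion-exclusion {p} {q} cliques⊆p∪q = begin
      cliquesIn G p + cliquesIn G q
        ≡⟨ countB-inclusion-exclusion (λ X → subsetB X p) (λ X → subsetB X q) (isCliqueB G) cliques⊆p∪q Xs ⟩
      countB (isCliqueB G) Xs + countB (λ X → (subsetB X p ∧ subsetB X q) ∧ isCliqueB G X) Xs
        ≡⟨ cong₂ _+_ (countB-cong (λ X → cong (_∧ isCliqueB G X) (sym (subsetB-⊤ X))) Xs)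
                     (countB-cong (λ X → cong (_∧ isCliqueB G X) (sym (subsetB-∩ X p q))) Xs) ⟩
      cliquesIn G ⊤ + cliquesIn G (p ∩ q)
        ∎
      where
      open ≡-Reasoning
      Xs : List (Subset n)
      Xs = allSubsets n

    edgesIn-inclusion-exclusion : ∀ {p q} → (∀ i j → T (adj G i j) → T (pairIn p i j ∨ pairIn q i j)) →
      edgesIn G p + edgesIn G q ≡ edgesIn G ⊤ + edgesIn G (p ∩ q)
    edgesIn-inclusion-exclusion {p} {q} edges⊆p∪q = begin
      edgesIn G p + edgesIn G q
        ≡⟨ cong₂ _+_ (edgesIn≡countPairs-pairIn p) (edgesIn≡countPairs-pairIn q) ⟩
      countPairs (λ i j → pairIn p i j ∧ E i j) + countPairs (λ i j → pairIn q i j ∧ E i j)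
        ≡⟨ countPairs-inclusion-exclusion (pairIn p) (pairIn q) E
             (λ i j → edges⊆p∪q i j ∘ proj₂ ∘ to (T-∧ {toℕ i <ᵇ toℕ j})) ⟩
      countPairs E + countPairs (λ i j → (pairIn p i j ∧ pairIn q i j) ∧ E i j)
        ≡⟨ cong₂ _+_ (countPairs-cong (λ i j → cong (_∧ E i j) (sym (pairIn-⊤ i j))))
                     (countPairs-cong (λ i j → cong (_∧ E i j) (sym (pairIn-∩ p q i j)))) ⟩
      countPairs (λ i j → pairIn ⊤ i j ∧ E i j) + countPairs (λ i j → pairIn (p ∩ q) i j ∧ E i j)
        ≡⟨ cong₂ _+_ (edgesIn≡countPairs-pairIn ⊤) (edgesIn≡countPairs-pairIn (p ∩ q)) ⟨
      edgesIn G ⊤ + edgesIn G (p ∩ q)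
        ∎
      where
      open ≡-Reasoning
      E : Fin n → Fin n → Bool
      E i j = (toℕ i <ᵇ toℕ j) ∧ adj G i j

  module Decomposition {n : ℕ} (G : Graph n) {S₁ S₂ : Subset n}
    (cover : S₁ ∪ S₂ ≡ ⊤)
    (separated : ∀ i j → T (adj G i j) → (i ∈ S₁ × j ∈ S₁) ⊎ (i ∈ S₂ × j ∈ S₂)) where

    ∉S₁⇒∈S₂ : ∀ {i} → i ∉ S₁ → i ∈ S₂
    ∉S₁⇒∈S₂ {i} i∉S₁ =
      Sum.[ ⊥-elim ∘ i∉S₁ , (λ i∈S₂ → i∈S₂) ] (x∈p∪q⁻ S₁ S₂ (subst (i ∈_) (sym cover) ∈⊤))

    clique-⊆S₂ : ∀ {X i} → T (isCliqueB G X) → i ∈ X → i ∉ S₁ → X ⊆ S₂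
    clique-⊆S₂ {X} {i} clique i∈X i∉S₁ {j} j∈X with i ≟ j
    ... | yes refl = ∉S₁⇒∈S₂ i∉S₁
    ... | no i≢j with separated i j (to (T-isCliqueB G X) clique i∈X j∈X i≢j)
    ...   | inj₁ (i∈S₁ , _) = ⊥-elim (i∉S₁ i∈S₁)
    ...   | inj₂ (_ , j∈S₂) = j∈S₂

    clique-⊆-side : ∀ {X} → T (isCliqueB G X) → X ⊆ S₁ ⊎ X ⊆ S₂
    clique-⊆-side {X} clique with any? (λ i → i ∈? X ×-dec ¬? (i ∈? S₁))
    ... | yes (i , i∈X , i∉S₁) = inj₂ (clique-⊆S₂ clique i∈X i∉S₁)
    ... | no ∄ = inj₁ (λ {i} i∈X → decidable-stable (i ∈? S₁) (λ i∉S₁ → ∄ (i , i∈X , i∉S₁)))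

    vertices-additive : n + ∣ S₁ ∩ S₂ ∣ ≡ ∣ S₁ ∣ + ∣ S₂ ∣
    vertices-additive = trans
      (cong (_+ ∣ S₁ ∩ S₂ ∣) (trans (sym (∣⊤∣≡n n)) (cong ∣_∣ (sym cover))))
      (sym (∣p∣+∣q∣≡∣p∪q∣+∣p∩q∣ S₁ S₂))

    module _ (core : T (isCliqueB G (S₁ ∩ S₂))) where

      cliquesIn-additive : cliquesIn G ⊤ + 2 ^ ∣ S₁ ∩ S₂ ∣ ≡ cliquesIn G S₁ + cliquesIn G S₂
      cliquesIn-additive = trans
        (cong (cliquesIn G ⊤ +_) (sym (cliquesIn-complete G {S₁ ∩ S₂} core)))
        (sym (cliquesIn-inclusion-exclusion G {S₁} {S₂} λ X clique →
          from T-∨ (Sum.map (from (T-subsetB X S₁)) (from (T-subsetB X S₂)) (clique-⊆-side clique))))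

      edgesIn-additive : edgesIn G ⊤ + ∣ S₁ ∩ S₂ ∣ C 2 ≡ edgesIn G S₁ + edgesIn G S₂
      edgesIn-additive = trans
        (cong (edgesIn G ⊤ +_) (sym (edgesIn-complete G {S₁ ∩ S₂} core)))
        (sym (edgesIn-inclusion-exclusion G {S₁} {S₂} λ i j edge →
          from T-∨ (Sum.map (from (T-pairIn S₁ i j)) (from (T-pairIn S₂ i j)) (separated i j edge))))

module Rationals where
  open import Data.Integer as ℤ using (+_)
  import Data.Integer.Properties as ℤ
  import Data.Nat as ℕ
  open import Data.Nat.Coprimality using (1-coprimeTo) renaming (sym to coprime-sym)
  open import Data.Rational using (ℚ; mkℚ; _/_; _+_; _*_; _≤_; -_)
  open import Data.Rational.Properties
    using (normalize-coprime; +-mono-≤; +-monoˡ-≤; +-monoʳ-≤; module ≤-Reasoning)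
  open import Data.Rational.Solver using (module +-*-Solver)
  open +-*-Solver using (solve; _:+_; _:*_; _:-_; _:=_)
  open import Relation.Binary.PropositionalEquality
  open import Defs using (ℕtoℚ)

  ℕtoℚ≡mkℚ : ∀ a → ℕtoℚ a ≡ mkℚ (+ a) 0 (coprime-sym (1-coprimeTo a))
  ℕtoℚ≡mkℚ a = normalize-coprime (coprime-sym (1-coprimeTo a))

  ℕtoℚ-+ : ∀ a b → ℕtoℚ (a ℕ.+ b) ≡ ℕtoℚ a + ℕtoℚ b
  ℕtoℚ-+ a b = begin
    ℕtoℚ (a ℕ.+ b)
      ≡⟨ cong (_/ 1) (cong₂ ℤ._+_ (ℤ.*-identityʳ (+ a)) (ℤ.*-identityʳ (+ b))) ⟨
    ((+ a) ℤ.* (+ 1) ℤ.+ (+ b) ℤ.* (+ 1)) / 1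
      ≡⟨⟩
    mkℚ (+ a) 0 (coprime-sym (1-coprimeTo a)) + mkℚ (+ b) 0 (coprime-sym (1-coprimeTo b))
      ≡⟨ cong₂ _+_ (ℕtoℚ≡mkℚ a) (ℕtoℚ≡mkℚ b) ⟨
    ℕtoℚ a + ℕtoℚ b
      ∎
    where open ≡-Reasoning

  ℕtoℚ-+-≡ : ∀ a b c d → a ℕ.+ b ≡ c ℕ.+ d → ℕtoℚ a + ℕtoℚ b ≡ ℕtoℚ c + ℕtoℚ d
  ℕtoℚ-+-≡ a b c d eq = trans (sym (ℕtoℚ-+ a b)) (trans (cong ℕtoℚ eq) (ℕtoℚ-+ c d))

  +-cancelʳ-≤ : ∀ p q r → p + r ≤ q + r → p ≤ q
  +-cancelʳ-≤ p q r p+r≤q+r = subst₂ _≤_ (cancel p) (cancel q) (+-monoˡ-≤ (- r) p+r≤q+r)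
    where
    cancel : ∀ p → p + r + - r ≡ p
    cancel p = solve 2 (λ p r → p :+ r :- r := p) refl p r

  module _ (x y z : ℚ) where

    affine-+ : ∀ a b a′ b′ →
      (x * a + y * b + z) + (x * a′ + y * b′ + z) ≡ x * (a + a′) + y * (b + b′) + z + z
    affine-+ = solve 7 (λ x y z a b a′ b′ →
      (x :* a :+ y :* b :+ z) :+ (x :* a′ :+ y :* b′ :+ z) := x :* (a :+ a′) :+ y :* (b :+ b′) :+ z :+ z)
      refl x y z

    affine-bound-glue : ∀ {c c₁ c₂ p n n₁ n₂ k m m₁ m₂ l} →
      c₁ ≤ x * n₁ + y * m₁ + z → c₂ ≤ x * n₂ + y * m₂ + z → x * k + y * l + z ≤ p →
      c + p ≡ c₁ + c₂ → n + k ≡ n₁ + n₂ → m + l ≡ m₁ + m₂ →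
      c ≤ x * n + y * m + z
    affine-bound-glue {c} {c₁} {c₂} {p} {n} {n₁} {n₂} {k} {m} {m₁} {m₂} {l} c₁≤ c₂≤ ≤p c+p≡ n+k≡ m+l≡ =
      +-cancelʳ-≤ c (bound n m) p (begin
        c + p                                    ≡⟨ c+p≡ ⟩
        c₁ + c₂                                  ≤⟨ +-mono-≤ c₁≤ c₂≤ ⟩
        bound n₁ m₁ + bound n₂ m₂                ≡⟨ affine-+ n₁ m₁ n₂ m₂ ⟩
        x * (n₁ + n₂) + y * (m₁ + m₂) + z + z    ≡⟨ cong₂ (λ a b → x * a + y * b + z + z) n+k≡ m+l≡ ⟨
        x * (n + k) + y * (m + l) + z + z        ≡⟨ affine-+ n m k l ⟨
        bound n m + bound k l                    ≤⟨ +-monoʳ-≤ (bound n m) ≤p ⟩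
        bound n m + p                            ∎)
      where
      open ≤-Reasoning
      bound : ℚ → ℚ → ℚ
      bound a b = x * a + y * b + z

open import Defs
open import Data.Nat using (ℕ; _^_)
open import Data.Nat.Combinatorics using (_C_)
open import Data.Fin using (Fin)
open import Data.Fin.Subset using (Subset; _∈_; _∩_; _∪_; ⊤; ∣_∣)
open import Data.Bool using (T)
open import Data.Product using (_×_)
open import Data.Sum using (_⊎_)
open import Relation.Binary.PropositionalEquality using (_≡_; refl)
open import Data.Rational using (ℚ; _+_; _*_; _≤_)
open Graphs using (module Decomposition)
open Rationals using (affine-bound-glue; ℕtoℚ-+-≡)

corollary1 :
    (n : ℕ) (G : Graph n) (S₁ S₂ : Subset n) (k : ℕ) (x y z : ℚ) →
    S₁ ∪ S₂ ≡ ⊤ →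
    (∀ i j → T (adj G i j) → (i ∈ S₁ × j ∈ S₁) ⊎ (i ∈ S₂ × j ∈ S₂)) →
    ∣ S₁ ∩ S₂ ∣ ≡ k →
    T (isCliqueB G (S₁ ∩ S₂)) →
    ℕtoℚ (cliquesIn G S₁) ≤ x * ℕtoℚ ∣ S₁ ∣ + y * ℕtoℚ (edgesIn G S₁) + z →
    ℕtoℚ (cliquesIn G S₂) ≤ x * ℕtoℚ ∣ S₂ ∣ + y * ℕtoℚ (edgesIn G S₂) + z →
    x * ℕtoℚ k + y * ℕtoℚ (k C 2) + z ≤ ℕtoℚ (2 ^ k) →
    ℕtoℚ (cliquesIn G ⊤) ≤ x * ℕtoℚ n + y * ℕtoℚ (edgesIn G ⊤) + z
corollary1 n G S₁ S₂ k x y z cover separated refl core c₁≤ c₂≤ cₖ≤ =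
  affine-bound-glue x y z c₁≤ c₂≤ cₖ≤
    (ℕtoℚ-+-≡ (cliquesIn G ⊤) (2 ^ k) (cliquesIn G S₁) (cliquesIn G S₂) (cliquesIn-additive core))
    (ℕtoℚ-+-≡ n k ∣ S₁ ∣ ∣ S₂ ∣ vertices-additive)
    (ℕtoℚ-+-≡ (edgesIn G ⊤) (k C 2) (edgesIn G S₁) (edgesIn G S₂) (edgesIn-additive core))
  where open Decomposition G cover separated
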